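{- (i) Let $k\ge 1$, let $\xi_0,\dots,\xi_k,\theta_0,\dots,\theta_k\in\mathrm{Inj}(\mathbb{N})$, and for $\tau\in\mathrm{Inj}(\mathbb{N})$ let $\tilde\varphi(\tau)=\xi_k\tau\xi_{k-1}\tau\cdots\tau\xi_0$ and $\tilde\psi(\tau)=\theta_k\tau\theta_{k-1}\tau\cdots\tau\theta_0$. If $\tilde\varphi(\mathrm{id}_{\mathbb{N}})\neq\tilde\psi(\mathrm{id}_{\mathbb{N}})$, then $\{\tau\in\mathrm{Inj}(\mathbb{N}):\tilde\varphi(\tau)\neq\tilde\psi(\tau)\}$ is an open neighbourhood of $\mathrm{id}_{\mathbb{N}}$ in the topology of pointwise convergence on $\mathrm{Inj}(\mathbb{N})$. (ii) Let $k\ge1$, let $p_0,\dots,p_k,q_0,\dots,q_k\in\mathrm{End}(\mathbb{G})$, and for $s\in\mathrm{End}(\mathbb{G})$ let $\varphi(s)=p_ks p_{k-1}s\cdots sp_0$ and $\psi(s)=q_ksq_{k-1}s\cdots sq_0$. Let $\tilde\varphi(\tau)=\tilde p_k\tau\tilde p_{k-1}\tau\cdots\tau\tilde p_0$ and $\tilde\psi(\tau)=\tilde q_k\tau\tilde q_{k-1}\tau\cdots\tau\tilde q_0$ for $\tau\in\mathrm{Inj}(\mathbb{N})$, and assume $\tilde\varphi(\mathrm{id}_{\mathbb{N}})\neq\tilde\psi(\mathrm{id}_{\mathbb{N}})$. Then there exists an open neighbourhood $U$ of $\mathrm{id}_{\mathbb{N}}$ in the topology of pointwise convergence on $\mathrm{Inj}(\mathbb{N})$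 such that $\tau\ltimes t\in M_{\varphi,\psi}=\{s\in\mathrm{End}(\mathbb{G}):\varphi(s)\neq\psi(s)\}$ for all $\tau\in U$ and all $t\in\mathrm{End}(\mathbb{K}_{2,\omega})$. In particular, $\tau\ltimes c_{ -1}\in M_{\varphi,\psi}$ for all $\tau\in U$.
   Context: $\mathrm{Inj}(\mathbb{N})$ is the monoid of injective maps $\mathbb{N}\to\mathbb{N}$, with the topology of pointwise convergence (subspace of the product topology on $\mathbb{N}^{\mathbb{N}}$, discrete factors). $\mathbb{K}_{2,\omega}$ is the graph on $K_{2,\omega}=A_{+1}\sqcup A_{ -1}$ ($A_{\pm1}$ disjoint countably infinite) with edge relation $A_{ -1}\times A_{+1}\cup A_{+1}\times A_{ -1}$. $\mathbb{G}$ is the structure on $G=\mathbb{N}\times K_{2,\omega}$ with relations $E_1=\{((i,x),(j,y)):i\neq j\}$ and $E_2=\{((i,x),(j,y)):i=j,\ (x,y)\text{ an edge of }\mathbb{K}_{2,\omega}\}$. Every $p\in\mathrm{End}(\mathbb{G})$ has the form $(i,x)\mapsto(\xi(i),p_i(x))$ for a unique $\xi\in\mathrm{Inj}(\mathbb{N})$ and some $p_i\in\mathrm{End}(\mathbb{K}_{2,\omega})$; write $\tilde p:=\xi$. For $\tau\colon\mathbb{N}\to\mathbb{N}$ and $t\colon K_{2,\omega}\to K_{2,\omega}$, $\tau\ltimes t$ is the map $(i,x)\mapsto(\tau(i),t(x))$ on $G$. Fix $a_{+1}\in A_{+1}$, $a_{ -1}\in A_{ -1}$; $c_{ -1}\in\mathrm{End}(\mathbb{K}_{2,\omega})$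 is the map sending every element of $A_e$ to $a_{ -e}$ for $e=\pm1$. -}

module Defs where

open import Data.Nat using (ℕ; zero; suc)
open import Data.Bool using (Bool; true; false; not)
open import Data.Fin using (Fin; fromℕ; inject₁)
open import Data.Product using (Σ; ∃; _×_; _,_; proj₁; proj₂)
open import Data.Sum using (_⊎_)
open import Data.List using (List)
open import Data.List.Membership.Propositional using (_∈_)
open import Relation.Binary.PropositionalEquality using (_≡_; _≢_)
open import Function using (_∘_; id)
open import Function.Definitions using (Injective)

InjN : Set
InjN = Σ (ℕ → ℕ) (λ f → Injective _≡_ _≡_ f)

fn : InjN → ℕ → ℕ
fn = proj₁

idInj : InjN
idInj = id , λ e → e

-- A subset U ⊆ Inj(ℕ) is open in the topology of pointwise convergence
-- iff every τ ∈ U has a basic neighbourhood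
-- {σ ∈ Inj(ℕ) : σ agrees with τ on the finite set F} contained in U.
IsOpen : (InjN → Set) → Set
IsOpen U = ∀ τ → U τ → ∃ λ (F : List ℕ) →
  ∀ σ → (∀ x → x ∈ F → fn σ x ≡ fn τ x) → U σ

IsOpenNbhdId : (InjN → Set) → Set
IsOpenNbhdId U = IsOpen U × U idInj

-- Words  a_k ∘ s ∘ a_{k-1} ∘ s ∘ ⋯ ∘ s ∘ a_0

word : {A : Set} (k : ℕ) → (Fin (suc k) → A → A) → (A → A) → A → A
word zero    a s = a Fin.zero
word (suc k) a s = a (fromℕ (suc k)) ∘ s ∘ word k (a ∘ inject₁) s

-- Inequality of maps (read constructively as apartness: they differ at some point).
Apart : {A B : Set} → (A → B) → (A → B) → Set
Apart f g = ∃ λ x → f x ≢ g x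

-- K_{2,ω} : A_{+1} = {true} × ℕ,  A_{-1} = {false} × ℕ

K : Set
K = Bool × ℕ

EdgeK : K → K → Set
EdgeK x y = (proj₁ x ≡ false × proj₁ y ≡ true) ⊎ (proj₁ x ≡ true × proj₁ y ≡ false)

IsEndK : (K → K) → Set
IsEndK t = ∀ x y → EdgeK x y → EdgeK (t x) (t y)

a₊ : K
a₊ = true , 0

c₋₁ : K → K
c₋₁ (b , _) = not b , 0

G : Set
G = ℕ × K

E₁ : G → G → Set
E₁ u v = proj₁ u ≢ proj₁ v

E₂ : G → G → Set
E₂ u v = proj₁ u ≡ proj₁ v × EdgeK (proj₂ u) (proj₂ v)

IsEndG : (G → G) → Set
IsEndG p = (∀ u v → E₁ u v → E₁ (p u) (p v)) × (∀ u v → E₂ u v → E₂ (p u) (p v))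

EndG : Set
EndG = Σ (G → G) IsEndG

-- p̃ : the injection ξ with p(i,x) = (ξ(i), p_i(x)); ξ(i) does not depend on x
-- (K_{2,ω} is connected and p preserves E₂), so we read it off at a₊.
tilde : (G → G) → ℕ → ℕ
tilde p i = proj₁ (p (i , a₊))

_⋉_ : (ℕ → ℕ) → (K → K) → G → G
(τ ⋉ t) (i , x) = τ i , t x

InM : (k : ℕ) → (p q : Fin (suc k) → EndG) → (G → G) → Set
InM k p q s = IsEndG s × Apart (word k (proj₁ ∘ p) s) (word k (proj₁ ∘ q) s)

-- The value of a word a_k s a_{k-1} s ⋯ s a_0 at x depends on s only at the
-- k intermediate values of the computation, so once two words differ at x
-- they keep differing for every s agreeing with the given one on those
-- finitely many points: apartness is open. For (ii), endomorphisms of 𝔾 act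
-- fibrewise, (i , x) ↦ (p̃ i , _), so the first coordinate of φ(τ ⋉ t) is
-- φ̃(τ); an apartness of φ̃(τ) and ψ̃(τ) therefore lifts to one of φ(τ ⋉ t)
-- and ψ(τ ⋉ t), whatever t is.
module Submission where

open import Defs
open import Data.Nat using (ℕ; zero; suc; _≤_)
open import Data.Bool using (true; false)
open import Data.Fin using (Fin; fromℕ; inject₁)
open import Data.Product using (∃; _×_; _,_; proj₁; proj₂)
open import Data.Sum using (inj₁; inj₂)
open import Data.List using (List; []; _∷_; _++_)
open import Data.List.Relation.Unary.Any using (here; there)
open import Data.List.Membership.Propositional using (_∈_)
open import Data.List.Membership.Propositional.Properties using (∈-++⁺ˡ; ∈-++⁺ʳ)
open import Relation.Binary.PropositionalEquality
open import Function using (_∘_; id)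

private
  variable
    A B : Set

queries : (k : ℕ) → (Fin (suc k) → A → A) → (A → A) → A → List A
queries zero    a s x = []
queries (suc k) a s x = word k (a ∘ inject₁) s x ∷ queries k (a ∘ inject₁) s x

word-cong-queries : (k : ℕ) (a : Fin (suc k) → A → A) (σ τ : A → A) (x : A) →
  (∀ y → y ∈ queries k a τ x → σ y ≡ τ y) → word k a σ x ≡ word k a τ x
word-cong-queries zero    a σ τ x agree = refl
word-cong-queries (suc k) a σ τ x agree = cong (a (fromℕ (suc k))) (begin
  σ (word k (a ∘ inject₁) σ x)  ≡⟨ cong σ (word-cong-queries k (a ∘ inject₁) σ τ x (λ y → agree y ∘ there)) ⟩
  σ (word k (a ∘ inject₁) τ x)  ≡⟨ agree _ (here refl) ⟩
  τ (word k (a ∘ inject₁) τ x)  ∎)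
  where open ≡-Reasoning

word-apart-isOpen : (k : ℕ) (a b : Fin (suc k) → ℕ → ℕ) →
  IsOpen (λ τ → Apart (word k a (fn τ)) (word k b (fn τ)))
word-apart-isOpen k a b τ (x , ax≢bx) =
  queries k a (fn τ) x ++ queries k b (fn τ) x ,
  λ σ agree → x , λ ax≡bx → ax≢bx (begin
    word k a (fn τ) x  ≡⟨ sym (word-cong-queries k a (fn σ) (fn τ) x (λ y → agree y ∘ ∈-++⁺ˡ)) ⟩
    word k a (fn σ) x  ≡⟨ ax≡bx ⟩
    word k b (fn σ) x  ≡⟨ word-cong-queries k b (fn σ) (fn τ) x (λ y → agree y ∘ ∈-++⁺ʳ _) ⟩
    word k b (fn τ) x  ∎)
  where open ≡-Reasoning

word-semiconj : (k : ℕ) (π : A → B) (a : Fin (suc k) → A → A) (ā : Fin (suc k) → B → B)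
  (s : A → A) (s̄ : B → B) →
  (∀ j x → π (a j x) ≡ ā j (π x)) → (∀ x → π (s x) ≡ s̄ (π x)) →
  ∀ x → π (word k a s x) ≡ word k ā s̄ (π x)
word-semiconj zero    π a ā s s̄ πa πs x = πa Fin.zero x
word-semiconj (suc k) π a ā s s̄ πa πs x = begin
  π (a top (s (word k (a ∘ inject₁) s x)))  ≡⟨ πa top _ ⟩
  ā top (π (s (word k (a ∘ inject₁) s x)))  ≡⟨ cong (ā top) (πs _) ⟩
  ā top (s̄ (π (word k (a ∘ inject₁) s x)))  ≡⟨ cong (ā top ∘ s̄) (word-semiconj k π (a ∘ inject₁) (ā ∘ inject₁) s s̄ (πa ∘ inject₁) πs x) ⟩
  ā top (s̄ (word k (ā ∘ inject₁) s̄ (π x)))  ∎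
  where
  open ≡-Reasoning
  top = fromℕ (suc k)

-- (i , x) and (i , a₊) are E₂-adjacent or share the E₂-neighbour (i , false , 0),
-- and p preserves E₂, which forces equal first coordinates.
endG-fibred : (p : EndG) (g : G) → proj₁ (proj₁ p g) ≡ tilde (proj₁ p) (proj₁ g)
endG-fibred (p , _ , pE₂) (i , false , n) =
  proj₁ (pE₂ (i , false , n) (i , a₊) (refl , inj₁ (refl , refl)))
endG-fibred (p , _ , pE₂) (i , true , n) = begin
  proj₁ (p (i , true , n))   ≡⟨ sym (proj₁ (pE₂ (i , false , 0) (i , true , n) (refl , inj₁ (refl , refl)))) ⟩
  proj₁ (p (i , false , 0))  ≡⟨ proj₁ (pE₂ (i , false , 0) (i , a₊) (refl , inj₁ (refl , refl))) ⟩
  proj₁ (p (i , a₊))         ∎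
  where open ≡-Reasoning

⋉-isEndG : (τ : InjN) (t : K → K) → IsEndK t → IsEndG (fn τ ⋉ t)
⋉-isEndG τ t t-end =
  (λ _ _ i≢j τi≡τj → i≢j (proj₂ τ τi≡τj)) ,
  λ { (i , x) (j , y) (i≡j , xy) → cong (fn τ) i≡j , t-end x y xy }

c₋₁-isEndK : IsEndK c₋₁
c₋₁-isEndK (false , _) (true  , _) _               = inj₂ (refl , refl)
c₋₁-isEndK (true  , _) (false , _) _               = inj₁ (refl , refl)
c₋₁-isEndK (false , _) (false , _) (inj₁ (_ , ()))
c₋₁-isEndK (false , _) (false , _) (inj₂ (() , _))
c₋₁-isEndK (true  , _) (true  , _) (inj₁ (() , _))
c₋₁-isEndK (true  , _) (true  , _) (inj₂ (_ , ()))

word-⋉-proj₁ : (k : ℕ) (p : Fin (suc k) → EndG) (τ : ℕ → ℕ) (t : K → K) (g : G) →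
  proj₁ (word k (proj₁ ∘ p) (τ ⋉ t) g) ≡ word k (tilde ∘ proj₁ ∘ p) τ (proj₁ g)
word-⋉-proj₁ k p τ t =
  word-semiconj k proj₁ (proj₁ ∘ p) (tilde ∘ proj₁ ∘ p) (τ ⋉ t) τ (endG-fibred ∘ p) (λ _ → refl)

inM-⋉ : (k : ℕ) (p q : Fin (suc k) → EndG) (τ : InjN) →
  Apart (word k (tilde ∘ proj₁ ∘ p) (fn τ)) (word k (tilde ∘ proj₁ ∘ q) (fn τ)) →
  (t : K → K) → IsEndK t → InM k p q (fn τ ⋉ t)
inM-⋉ k p q τ (i , p̃i≢q̃i) t t-end = ⋉-isEndG τ t t-end , (i , a₊) , λ pg≡qg → p̃i≢q̃i (begin
  word k (tilde ∘ proj₁ ∘ p) (fn τ) i  ≡⟨ sym (word-⋉-proj₁ k p (fn τ) t (i , a₊)) ⟩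
  proj₁ (word k (proj₁ ∘ p) (fn τ ⋉ t) (i , a₊))  ≡⟨ cong proj₁ pg≡qg ⟩
  proj₁ (word k (proj₁ ∘ q) (fn τ ⋉ t) (i , a₊))  ≡⟨ word-⋉-proj₁ k q (fn τ) t (i , a₊) ⟩
  word k (tilde ∘ proj₁ ∘ q) (fn τ) i  ∎)
  where open ≡-Reasoning

lemma4p11 :
    ((k : ℕ) → 1 ≤ k → (ξ θ : Fin (suc k) → InjN) →
      Apart (word k (fn ∘ ξ) id) (word k (fn ∘ θ) id) →
      IsOpenNbhdId (λ τ → Apart (word k (fn ∘ ξ) (fn τ)) (word k (fn ∘ θ) (fn τ))))
    ×
    ((k : ℕ) → 1 ≤ k → (p q : Fin (suc k) → EndG) →
      Apart (word k (tilde ∘ proj₁ ∘ p) id) (word k (tilde ∘ proj₁ ∘ q) id) →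
      ∃ λ (U : InjN → Set) → IsOpenNbhdId U ×
        ((τ : InjN) → U τ → (t : K → K) → IsEndK t → InM k p q (fn τ ⋉ t)) ×
        ((τ : InjN) → U τ → InM k p q (fn τ ⋉ c₋₁)))
lemma4p11 =
  (λ k _ ξ θ apart-at-id → word-apart-isOpen k (fn ∘ ξ) (fn ∘ θ) , apart-at-id) ,
  λ k _ p q apart-at-id →
    (λ τ → Apart (word k (tilde ∘ proj₁ ∘ p) (fn τ)) (word k (tilde ∘ proj₁ ∘ q) (fn τ))) ,
    (word-apart-isOpen k (tilde ∘ proj₁ ∘ p) (tilde ∘ proj₁ ∘ q) , apart-at-id) ,
    inM-⋉ k p q ,
    λ τ τ∈U → inM-⋉ k p q τ τ∈U c₋₁ c₋₁-isEndK
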